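{- Let $n\ge4$ be even and let $C_0$ be the $C$-wave configuration of $H_n$ of length $n$ whose only interrupter is $v_{0,2}$ (column indices modulo $n$, so $v_{0,2}=v_{n,2}$). Consider the $\frac12$-power index process on $H_n$ with initial configuration $C_0$. Then for every $k\ge0$ and every column $i$, the configuration $C_k$ has an interrupter in column $i$ (that is, $C_k(v_{i,1})\ne W(v_{i,1})$ or $C_k(v_{i,2})\ne W(v_{i,2})$) if and only if cell $c_i$ is live at time $k$ in the cylindrical Rule 90 cellular automaton of length $n$ seeded with the single live cell $c_0$.
   Context: All graphs are finite and simple. A configuration of a graph $G$ is a map $C:V(G)\to\{C,D\}$; vertices with value $C$ are collaborators, those with value $D$ defectors. $N[v]$ is the closed neighbourhood of $v$, $N_C[v]$ is the set of collaborators in $N[v]$ and $N_D[v]$ the set of defectors in $N[v]$. For $w=\frac12$, the power of $v$ is: if $v$ is a collaborator, $p(v)=1/|N_C[v]|$ when $|N_C[v]|/|N[v]|>w$ and $0$ otherwise; if $v$ is a defector, $p(v)=1/|N_D[v]|$ when $|N_C[v]|/|N[v]|\le w$ and $0$ otherwise. The $w$-power index process produces $C_1,C_2,\dots$ from $C_0$: for $t\ge1$ each vertex $v$ simultaneously takes the strategy that, in $C_{t-1}$, is held by the vertex of $N[v]$ of greatest power (computed w.r.t. $C_{t-1}$); if the vertices of $N[v]$ of greatest power have differing strategies, $C_t(v)=C_{t-1}(v)$. The graph $H_n$: start from $C_n\square P_2$ with vertices $v_{i,j}$ ($i$ modulo $n$, $j\in\{1,2\}$), where $v_{i,j}\sim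 v_{i\pm1,j}$ and $v_{i,1}\sim v_{i,2}$; for each $v_{i,j}$ add a triangle on new vertices $x_{i,j},y_{i,j},z_{i,j}$ and the edge $v_{i,j}z_{i,j}$. The configuration $W$ assigns $C$ to $v_{i,1},x_{i,1},y_{i,1},z_{i,1}$ and $D$ to $v_{i,2},x_{i,2},y_{i,2},z_{i,2}$ for all $i$. A wave configuration of length $n$ is obtained from $W$ by changing the strategy of the vertices in a set $I\subseteq\{v_{1,j},\dots,v_{n,j}\}$ for a single fixed $j$, such that $i_1\equiv i_2 \pmod 2$ whenever $v_{i_1,j},v_{i_2,j}\in I$; the elements of $I$ are its interrupters; it is a $C$-wave configuration if the interrupters are collaborators ($j=2$). The cylindrical Rule 90 automaton of length $n$ has cells $c_0,\dots,c_{n-1}$ (indices modulo $n$), each live or dead at each time $t\in\{0,1,2,\dots\}$; cell $c_i$ is live at time $t+1$ if and only if exactly one of $c_{i-1}$ and $c_{i+1}$ is live at time $t$; the seed is the state at time $0$. -}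

module Defs where

open import Data.Nat as ℕ using (ℕ; zero; suc)
open import Data.Bool using (Bool; true; false; _∧_; _∨_; not; if_then_else_)
open import Data.Fin as Fin using (Fin; toℕ)
open import Data.List using (List; []; _∷_; filterᵇ; length; map; foldr; concatMap)
open import Data.List using (allFin)
open import Data.Integer using (+_)
open import Data.Rational using (ℚ; _/_; 0ℚ; ½; _⊔_; _<_)
open import Data.Rational.Properties using (_<?_) renaming (_≟_ to _≟ℚ_)
open import Data.Product using (_×_; _,_)
open import Relation.Nullary using (Dec; yes; no; does)
open import Relation.Binary.PropositionalEquality using (_≡_)

record Graph : Set₁ where
  field
    V     : Set
    verts : List V
    _==_  : V → V → Bool
    adj   : V → V → Bool           -- (symmetric, irreflexive) adjacency

data Strategy : Set where
  C D : Strategy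

isC : Strategy → Bool
isC C = true
isC D = false

isD : Strategy → Bool
isD s = not (isC s)

allB : ∀ {A : Set} → (A → Bool) → List A → Bool
allB p []       = true
allB p (x ∷ xs) = p x ∧ allB p xs

Config : Graph → Set
Config G = Graph.V G → Strategy

module Process (G : Graph) where
  open Graph G

  N[_] : V → List V
  N[ v ] = filterᵇ (λ u → (u == v) ∨ adj v u) verts

  module _ (σ : Config G) where
    NC[_] : V → List V
    NC[ v ] = filterᵇ (λ u → isC (σ u)) N[ v ]

    ND[_] : V → List V
    ND[ v ] = filterᵇ (λ u → isD (σ u)) N[ v ]

    -- |N_C[v]| / |N[v]|  (N[v] always contains v, so the denominator is ≥ 1)
    ratioC : V → ℚ
    ratioC v with length N[ v ]
    ... | zero  = 0ℚ
    ... | suc m = + length NC[ v ] / suc m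

    -- 1 / k  (with 1/0 := 0, never used: v itself lies in the relevant set)
    inv : ℕ → ℚ
    inv zero    = 0ℚ
    inv (suc m) = + 1 / suc m

    power : V → ℚ
    power v with σ v
    ... | C = if does (½ <? ratioC v) then inv (length NC[ v ]) else 0ℚ
    ... | D = if does (½ <? ratioC v) then 0ℚ else inv (length ND[ v ])

    maxPower : V → ℚ
    maxPower v = foldr (λ u q → power u ⊔ q) 0ℚ N[ v ]

    strongest : V → List V
    strongest v = filterᵇ (λ u → does (power u ≟ℚ maxPower v)) N[ v ]

    step : Config G
    step v =
      if allB (λ u → isC (σ u)) (strongest v) then C
      else if allB (λ u → isD (σ u)) (strongest v) then D
      else σ v

  run : Config G → ℕ → Config G
  run σ zero    = σ
  run σ (suc k) = step (run σ k)

finEq : ∀ {n} → Fin n → Fin n → Bool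
finEq i i' = does (toℕ i ℕ.≟ toℕ i')

nextMod : ∀ (n : ℕ) → Fin n → Fin n → Bool
nextMod n i i' = does (toℕ i' ℕ.≟ suc (toℕ i))
               ∨ (does (suc (toℕ i) ℕ.≟ n) ∧ does (toℕ i' ℕ.≟ 0))

cycAdj : ∀ (n : ℕ) → Fin n → Fin n → Bool
cycAdj n i i' = nextMod n i i' ∨ nextMod n i' i

-- kind of vertex attached to column i, row j: v_{i,j}, x_{i,j}, y_{i,j}, z_{i,j}
data Kind : Set where
  kv kx ky kz : Kind

kindEq : Kind → Kind → Bool
kindEq kv kv = true
kindEq kx kx = true
kindEq ky ky = true
kindEq kz kz = true
kindEq _  _  = false

kinds : List Kind
kinds = kv ∷ kx ∷ ky ∷ kz ∷ []

-- a vertex: (column i, row j, kind); row zero is j = 1, row (suc zero) is j = 2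
HV : ℕ → Set
HV n = Fin n × Fin 2 × Kind

Hadj : ∀ (n : ℕ) → HV n → HV n → Bool
-- cycle edges v_{i,j} ~ v_{i±1,j}, and rung edges v_{i,1} ~ v_{i,2}
Hadj n (i , j , kv) (i' , j' , kv) =
  (finEq j j' ∧ cycAdj n i i') ∨ (finEq i i' ∧ not (finEq j j'))
-- pendant edges v_{i,j} ~ z_{i,j}
Hadj n (i , j , kv) (i' , j' , kz) = finEq i i' ∧ finEq j j'
Hadj n (i , j , kz) (i' , j' , kv) = finEq i i' ∧ finEq j j'
Hadj n (i , j , kv) (i' , j' , _)  = false
Hadj n (i , j , _)  (i' , j' , kv) = false
-- triangle x_{i,j} y_{i,j} z_{i,j}
Hadj n (i , j , k)  (i' , j' , k') = finEq i i' ∧ finEq j j' ∧ not (kindEq k k')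

H : ℕ → Graph
H n = record
  { V     = HV n
  ; verts = concatMap (λ i → concatMap (λ j → map (λ k → (i , j , k)) kinds)
                                       (allFin 2))
                      (allFin n)
  ; _==_  = λ { (i , j , k) (i' , j' , k') → finEq i i' ∧ finEq j j' ∧ kindEq k k' }
  ; adj   = Hadj n
  }

W : ∀ (n : ℕ) → Config (H n)
W n (i , Fin.zero , k)  = C
W n (i , Fin.suc _ , k) = D

flipS : Strategy → Strategy
flipS C = D
flipS D = C

waveC0 : ∀ (n : ℕ) → Config (H n)
waveC0 n (i , Fin.suc Fin.zero , kv) with toℕ i ℕ.≟ 0
... | yes _ = flipS (W n (i , Fin.suc Fin.zero , kv))
... | no  _ = W n (i , Fin.suc Fin.zero , kv)
waveC0 n v = W n v

vtx : ∀ {n} → Fin n → Fin 2 → HV n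
vtx i j = (i , j , kv)

rule90 : ∀ (n : ℕ) → ℕ → Fin n → Bool
rule90 n zero    i = does (toℕ i ℕ.≟ 0)
rule90 n (suc t) i =
  does (length (filterᵇ (λ i' → cycAdj n i i' ∧ rule90 n t i') (allFin n)) ℕ.≟ 1)

module Submission where

-- Call a configuration a wave on row r with interrupter set b when it
-- is W with exactly the cycle vertices v_{i,r}, b i = true, flipped; C_0 is
-- the wave on row 2 whose interrupters are the Rule 90 seed.  One step of the
-- process maps a wave on row r with interrupters b to the wave on the other
-- row with interrupters i ↦ b (i-1) xor b (i+1), provided b is sparse:
-- around every column i, either i ± 1 are free or i - 2, i, i + 2 are free.
-- Each such local update is checked by evaluating the process on all local
-- patterns.  On an even cycle the live cells of Rule 90 from a single seed
-- all have the parity of the time, so the interrupter sets stay sparse, and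
-- by induction C_k is the wave of the Rule 90 state at time k.

open import Defs
open import Data.Nat as ℕ using (ℕ; zero; suc; _≤_; s≤s; _*_)
open import Data.Nat.Properties using (1+n≢n; <-irrefl; ≡ᵇ⇒≡; ≡⇒≡ᵇ)
open import Data.Nat.Divisibility using (_∣_; divides)
open import Data.Integer using (+_)
open import Data.Rational using (ℚ; 0ℚ; ½; _⊔_; _/_)
open import Data.Rational.Properties using (⊔-assoc; ⊔-comm; _<?_) renaming (_≟_ to _≟ℚ_)
open import Data.Fin as Fin using (Fin; zero; suc; toℕ; fromℕ; inject₁)
open import Data.Fin.Properties using (toℕ-injective; toℕ-fromℕ; toℕ-inject₁; toℕ<n; all?)
open import Data.Fin.Relation.Unary.Top using (View; view; ‵fromℕ; ‵inj₁; view-fromℕ; view-inject₁)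
open import Data.Bool using (Bool; true; false; _∧_; _∨_; not; T; if_then_else_; _xor_)
open import Data.Bool.Properties as Bool using (∧-assoc; ∧-comm; T-∧; T-∨; T-≡; not-involutive; not-¬)
open import Data.Unit using (tt)
open import Data.Empty using (⊥-elim)
open import Data.Product using (_×_; _,_; proj₁; proj₂)
open import Data.Sum using (_⊎_; inj₁; inj₂)
open import Data.List using (List; []; _∷_; filterᵇ; length; map; foldr; concatMap; allFin)
open import Data.List.Properties using (length-map; map-cong; foldr-map)
open import Data.List.Relation.Unary.All as All using (All; []; _∷_)
import Data.List.Relation.Unary.All.Properties as All
open import Data.List.Relation.Unary.AllPairs as AllPairs using ([]; _∷_)
import Data.List.Relation.Unary.AllPairs.Properties as AllPairs
open import Data.List.Relation.Unary.Any using (here; there)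
open import Data.List.Relation.Unary.Unique.Propositional using (Unique)
import Data.List.Relation.Unary.Unique.Propositional.Properties as Unique
open import Data.List.Relation.Binary.Disjoint.Propositional using (Disjoint)
open import Data.List.Membership.Propositional using (_∈_)
open import Data.List.Membership.Propositional.Properties
  using (∈-filter⁺; ∈-filter⁻; ∈-allFin; ∈-map⁺; ∈-concat⁺′)
open import Data.List.Membership.Propositional.Properties.WithK using (unique∧set⇒bag)
open import Data.List.Relation.Binary.BagAndSetEquality using (∼bag⇒↭)
open import Data.List.Relation.Binary.Permutation.Propositional as ↭ using (_↭_)
open import Data.List.Relation.Binary.Permutation.Propositional.Properties using (↭-length; filter-↭)
open import Function using (_∘_)
open import Function.Bundles using (_⇔_; mk⇔; Equivalence)
open import Relation.Nullary using (Dec; yes; no; ¬_; does)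
open import Relation.Nullary.Decidable using (T?; from-yes; _×-dec_; _⊎-dec_; _→-dec_)
open import Relation.Binary.PropositionalEquality
  using (_≡_; _≢_; refl; sym; trans; cong; cong₂; subst; module ≡-Reasoning)

private variable
  A B : Set

-- The closed neighbourhood N[v] of the process is a
-- filter of the global vertex list; replacing it by an explicit list is
-- harmless because everything the process computes from N[v] is invariant
-- under permutation.

filter-enumeration-↭ : {xs ys : List A} (p : A → Bool) →
  Unique xs → (∀ x → x ∈ xs) → Unique ys → (∀ {x} → T (p x) ⇔ x ∈ ys) →
  filterᵇ p xs ↭ ys
filter-enumeration-↭ {xs = xs} p uxs all∈ uys p⇔ = ∼bag⇒↭ (unique∧set⇒bag
  (Unique.filter⁺ (λ x → T? (p x)) uxs) uys
  (mk⇔ (λ x∈ → Equivalence.to p⇔ (proj₂ (∈-filter⁻ (λ x → T? (p x)) {xs = xs} x∈)))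
       (λ x∈ → ∈-filter⁺ (λ x → T? (p x)) (all∈ _) (Equivalence.from p⇔ x∈))))

concatMap-unique : (f : A → List B) (tag : B → A) →
  (∀ x → All (λ b → tag b ≡ x) (f x)) → (∀ x → Unique (f x)) →
  {xs : List A} → Unique xs → Unique (concatMap f xs)
concatMap-unique f tag tagged uf uxs =
  Unique.concat⁺ (All.map⁺ (All.universal uf _))
                 (AllPairs.map⁺ (AllPairs.map disjoint uxs))
  where
  disjoint : ∀ {x y} → x ≢ y → Disjoint (f x) (f y)
  disjoint {x} {y} x≢y (b∈fx , b∈fy) =
    x≢y (trans (sym (All.lookup (tagged x) b∈fx)) (All.lookup (tagged y) b∈fy))

foldr-↭ : (f : A → B → B) → (∀ x y z → f x (f y z) ≡ f y (f x z)) →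
  (z : B) {xs ys : List A} → xs ↭ ys → foldr f z xs ≡ foldr f z ys
foldr-↭ f comm z ↭.refl         = refl
foldr-↭ f comm z (↭.prep x p)   = cong (f x) (foldr-↭ f comm z p)
foldr-↭ f comm z (↭.swap x y p) = trans (comm x y _) (cong (λ t → f y (f x t)) (foldr-↭ f comm z p))
foldr-↭ f comm z (↭.trans p q)  = trans (foldr-↭ f comm z p) (foldr-↭ f comm z q)

allB-foldr : (p : A → Bool) (xs : List A) → allB p xs ≡ foldr (λ x b → p x ∧ b) true xs
allB-foldr p []       = refl
allB-foldr p (x ∷ xs) = cong (p x ∧_) (allB-foldr p xs)

allB-↭ : (p : A → Bool) {xs ys : List A} → xs ↭ ys → allB p xs ≡ allB p ys
allB-↭ p {xs} {ys} xs↭ys = begin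
  allB p xs                           ≡⟨ allB-foldr p xs ⟩
  foldr (λ x b → p x ∧ b) true xs     ≡⟨ foldr-↭ _ ∧-leftComm true xs↭ys ⟩
  foldr (λ x b → p x ∧ b) true ys     ≡⟨ sym (allB-foldr p ys) ⟩
  allB p ys                           ∎
  where
  open ≡-Reasoning
  ∧-leftComm : ∀ x y z → p x ∧ (p y ∧ z) ≡ p y ∧ (p x ∧ z)
  ∧-leftComm x y z = trans (sym (∧-assoc (p x) (p y) z))
                    (trans (cong (_∧ z) (∧-comm (p x) (p y))) (∧-assoc (p y) (p x) z))

filterᵇ-map : (f : A → B) (p : B → Bool) (xs : List A) →
  filterᵇ p (map f xs) ≡ map f (filterᵇ (λ x → p (f x)) xs)
filterᵇ-map f p [] = refl
filterᵇ-map f p (x ∷ xs) with p (f x)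
... | true  = cong (f x ∷_) (filterᵇ-map f p xs)
... | false = filterᵇ-map f p xs

allB-map : (f : A → B) (p : B → Bool) (xs : List A) → allB p (map f xs) ≡ allB (λ x → p (f x)) xs
allB-map f p []       = refl
allB-map f p (x ∷ xs) = cong (p (f x) ∧_) (allB-map f p xs)

filterᵇ-∧ : (p q : A → Bool) (xs : List A) →
  filterᵇ (λ x → p x ∧ q x) xs ≡ filterᵇ q (filterᵇ p xs)
filterᵇ-∧ p q [] = refl
filterᵇ-∧ p q (x ∷ xs) with p x
... | false = filterᵇ-∧ p q xs
... | true with q x
...   | true  = cong (x ∷_) (filterᵇ-∧ p q xs)
...   | false = filterᵇ-∧ p q xs

exactly-one : (q : A → Bool) (a b : A) →
  does (length (filterᵇ q (a ∷ b ∷ [])) ℕ.≟ 1) ≡ q a xor q b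
exactly-one q a b with q a
... | true with q b
...   | true  = refl
...   | false = refl
exactly-one q a b | false with q b
...   | true  = refl
...   | false = refl

-- The update rule read off a list of (strategy, power) pairs.  These are the
-- definitions of Process with the closed neighbourhood replaced by a list.

count : (Strategy → Bool) → List Strategy → ℕ
count p ss = length (filterᵇ p ss)

ratio : ℕ → ℕ → ℚ
ratio c zero    = 0ℚ
ratio c (suc m) = + c / suc m

unitFraction : ℕ → ℚ
unitFraction zero    = 0ℚ
unitFraction (suc m) = + 1 / suc m

localPower : Strategy → List Strategy → ℚ
localPower C ss =
  if does (½ <? ratio (count isC ss) (length ss)) then unitFraction (count isC ss) else 0ℚ
localPower D ss =
  if does (½ <? ratio (count isC ss) (length ss)) then 0ℚ else unitFraction (count isD ss)

maxOf : List (Strategy × ℚ) → ℚ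
maxOf ps = foldr (λ p q → proj₂ p ⊔ q) 0ℚ ps

strongestOf : List (Strategy × ℚ) → List (Strategy × ℚ)
strongestOf ps = filterᵇ (λ p → does (proj₂ p ≟ℚ maxOf ps)) ps

localStep : Strategy → List (Strategy × ℚ) → Strategy
localStep s ps =
  if allB (λ p → isC (proj₁ p)) (strongestOf ps) then C
  else if allB (λ p → isD (proj₁ p)) (strongestOf ps) then D
  else s

-- For any graph, the process only sees closed neighbourhoods up to order:
-- given any listing nbhd v of N[v], one step is computed by localStep from
-- the snapshot of the listed neighbourhood.
module Locality (G : Graph) (nbhd : Graph.V G → List (Graph.V G))
                (N↭nbhd : ∀ v → Process.N[_] G v ↭ nbhd v) where
  open Graph G using (V)
  open Process G

  snapshot : Config G → V → List (Strategy × ℚ)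
  snapshot σ v = map (λ u → σ u , localPower (σ u) (map σ (nbhd u))) (nbhd v)

  count-↭ : (σ : Config G) (p : Strategy → Bool) (u : V) →
    length (filterᵇ (λ x → p (σ x)) N[ u ]) ≡ count p (map σ (nbhd u))
  count-↭ σ p u = begin
    length (filterᵇ (λ x → p (σ x)) N[ u ])  ≡⟨ ↭-length (filter-↭ _ (N↭nbhd u)) ⟩
    length kept                              ≡⟨ sym (length-map σ kept) ⟩
    length (map σ kept)                      ≡⟨ cong length (sym (filterᵇ-map σ p (nbhd u))) ⟩
    count p (map σ (nbhd u))                 ∎
    where
    open ≡-Reasoning
    kept : List V
    kept = filterᵇ (λ x → p (σ x)) (nbhd u)

  ratioC-local : (σ : Config G) (u : V) →
    ratioC σ u ≡ ratio (count isC (map σ (nbhd u))) (length (map σ (nbhd u)))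
  ratioC-local σ u = trans (ratioC-ratio σ u)
    (cong₂ ratio (count-↭ σ isC u) (trans (↭-length (N↭nbhd u)) (sym (length-map σ (nbhd u)))))
    where
    ratioC-ratio : ∀ σ u → ratioC σ u ≡ ratio (length (NC[_] σ u)) (length N[ u ])
    ratioC-ratio σ u with length N[ u ]
    ... | zero  = refl
    ... | suc _ = refl

  inv-unitFraction : (σ : Config G) (k : ℕ) → inv σ k ≡ unitFraction k
  inv-unitFraction σ zero    = refl
  inv-unitFraction σ (suc k) = refl

  power-local : (σ : Config G) (u : V) → power σ u ≡ localPower (σ u) (map σ (nbhd u))
  power-local σ u with σ u
  ... | C = cong₂ (λ r c → if does (½ <? r) then c else 0ℚ) (ratioC-local σ u)
              (trans (inv-unitFraction σ (length (NC[_] σ u))) (cong unitFraction (count-↭ σ isC u)))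
  ... | D = cong₂ (λ r c → if does (½ <? r) then 0ℚ else c) (ratioC-local σ u)
              (trans (inv-unitFraction σ (length (ND[_] σ u))) (cong unitFraction (count-↭ σ isD u)))

  profile : Config G → V → Strategy × ℚ
  profile σ u = σ u , power σ u

  maxPower-local : (σ : Config G) (v : V) → maxPower σ v ≡ maxOf (map (profile σ) (nbhd v))
  maxPower-local σ v = trans (foldr-↭ _ ⊔-leftComm 0ℚ (N↭nbhd v))
                             (sym (foldr-map _ (profile σ) 0ℚ (nbhd v)))
    where
    ⊔-leftComm : ∀ x y q → power σ x ⊔ (power σ y ⊔ q) ≡ power σ y ⊔ (power σ x ⊔ q)
    ⊔-leftComm x y q = trans (sym (⊔-assoc (power σ x) (power σ y) q))
      (trans (cong (_⊔ q) (⊔-comm (power σ x) (power σ y))) (⊔-assoc (power σ y) (power σ x) q))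

  strongest-local : (σ : Config G) (v : V) (q : Strategy → Bool) →
    allB (λ u → q (σ u)) (strongest σ v) ≡ allB (q ∘ proj₁) (strongestOf (map (profile σ) (nbhd v)))
  strongest-local σ v q = begin
    allB (q ∘ σ) (filterᵇ (atLevel (maxPower σ v)) N[ v ])
      ≡⟨ allB-↭ _ (filter-↭ _ (N↭nbhd v)) ⟩
    allB (q ∘ σ) (filterᵇ (atLevel (maxPower σ v)) (nbhd v))
      ≡⟨ cong (λ L → allB (q ∘ σ) (filterᵇ (atLevel L) (nbhd v))) (maxPower-local σ v) ⟩
    allB (q ∘ σ) strongestListed
      ≡⟨ sym (allB-map (profile σ) (q ∘ proj₁) strongestListed) ⟩
    allB (q ∘ proj₁) (map (profile σ) strongestListed)
      ≡⟨ cong (allB (q ∘ proj₁)) (sym (filterᵇ-map (profile σ) _ (nbhd v))) ⟩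
    allB (q ∘ proj₁) (strongestOf (map (profile σ) (nbhd v)))  ∎
    where
    open ≡-Reasoning
    atLevel : ℚ → V → Bool
    atLevel L u = does (power σ u ≟ℚ L)
    strongestListed : List V
    strongestListed = filterᵇ (atLevel (maxOf (map (profile σ) (nbhd v)))) (nbhd v)

  step-local : (σ : Config G) (v : V) → step σ v ≡ localStep (σ v) (snapshot σ v)
  step-local σ v = begin
    step σ v                                    ≡⟨ cong₂ (λ a b → if a then C else if b then D else σ v)
                                                         (strongest-local σ v isC) (strongest-local σ v isD) ⟩
    localStep (σ v) (map (profile σ) (nbhd v))  ≡⟨ cong (localStep (σ v))
                                                         (map-cong (λ u → cong (σ u ,_) (power-local σ u)) (nbhd v)) ⟩
    localStep (σ v) (snapshot σ v)              ∎
    where open ≡-Reasoning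

  step-cong : {σ τ : Config G} → (∀ x → σ x ≡ τ x) → ∀ v → step σ v ≡ step τ v
  step-cong {σ} {τ} σ≗τ v = begin
    step σ v                        ≡⟨ step-local σ v ⟩
    localStep (σ v) (snapshot σ v)  ≡⟨ cong₂ localStep (σ≗τ v) (map-cong same-profile (nbhd v)) ⟩
    localStep (τ v) (snapshot τ v)  ≡⟨ sym (step-local τ v) ⟩
    step τ v                        ∎
    where
    open ≡-Reasoning
    same-profile : ∀ u → (σ u , localPower (σ u) (map σ (nbhd u)))
                         ≡ (τ u , localPower (τ u) (map τ (nbhd u)))
    same-profile u = cong₂ _,_ (σ≗τ u) (cong₂ localPower (σ≗τ u) (map-cong σ≗τ (nbhd u)))

odd : ℕ → Bool
odd zero    = false
odd (suc k) = not (odd k)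

odd-double : ∀ q → odd (q * 2) ≡ false
odd-double zero    = refl
odd-double (suc q) = trans (not-involutive (odd (q * 2))) (odd-double q)

xor-true : ∀ a b → a xor b ≡ true → a ≡ true ⊎ b ≡ true
xor-true true  _    _ = inj₁ refl
xor-true false true _ = inj₂ refl

flip-parity : ∀ {x a y} → a ≡ not x → a ≡ y → x ≡ not y
flip-parity {x} refl refl = sym (not-involutive x)

2+n≢n : ∀ {k : ℕ} → suc (suc k) ≢ k
2+n≢n {suc k} eq = 2+n≢n {k} (cong ℕ.pred eq)

module Cycle (m : ℕ) where
  n : ℕ
  n = suc (suc (suc m))

  prev : Fin n → Fin n
  prev zero    = fromℕ _
  prev (suc i) = inject₁ i

  -- i + 1 (mod n), defined through the top-or-inject₁ view of Fin n so that
  -- it visibly inverts prev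
  nextᵛ : {i : Fin n} → View i → Fin n
  nextᵛ ‵fromℕ             = zero
  nextᵛ (‵inj₁ {i = j} _) = suc j

  next : Fin n → Fin n
  next i = nextᵛ (view i)

  next-fromℕ : next (fromℕ _) ≡ zero
  next-fromℕ = cong nextᵛ (view-fromℕ _)

  next-inject₁ : (j : Fin (suc (suc m))) → next (inject₁ j) ≡ suc j
  next-inject₁ j = cong nextᵛ (view-inject₁ j)

  next-prev : ∀ i → next (prev i) ≡ i
  next-prev zero    = next-fromℕ
  next-prev (suc j) = next-inject₁ j

  prev-next : ∀ i → prev (next i) ≡ i
  prev-next i = prevᵛ (view i)
    where
    prevᵛ : {i : Fin n} (w : View i) → prev (nextᵛ w) ≡ i
    prevᵛ ‵fromℕ   = refl
    prevᵛ (‵inj₁ _) = refl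

  toℕ-next : ∀ i → toℕ (next i) ≡ suc (toℕ i) ⊎ (toℕ (next i) ≡ 0 × toℕ i ≡ suc (suc m))
  toℕ-next i = cases (view i)
    where
    cases : {i : Fin n} (w : View i) →
            toℕ (nextᵛ w) ≡ suc (toℕ i) ⊎ (toℕ (nextᵛ w) ≡ 0 × toℕ i ≡ suc (suc m))
    cases ‵fromℕ             = inj₂ (refl , toℕ-fromℕ _)
    cases (‵inj₁ {i = j} _) = inj₁ (cong suc (sym (toℕ-inject₁ j)))

  -- the three vertices i - 1, i, i + 1 are distinct since n ≥ 3
  next≢ : ∀ i → next i ≢ i
  next≢ i e with toℕ-next i
  ... | inj₁ p         = 1+n≢n (trans (sym p) (cong toℕ e))
  ... | inj₂ (p₀ , p₁) with trans (trans (sym p₀) (cong toℕ e)) p₁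
  ... | ()

  next-next≢ : ∀ i → next (next i) ≢ i
  next-next≢ i e with toℕ-next i | toℕ-next (next i) | cong toℕ e
  ... | inj₁ p | inj₁ q | e′ = 2+n≢n (trans (sym (trans q (cong suc p))) e′)
  ... | inj₁ p | inj₂ (q₀ , q₁) | e′ with trans (sym q₁) (trans p (cong suc (trans (sym e′) q₀)))
  ... | ()
  next-next≢ i e | inj₂ (p₀ , p₁) | inj₁ q | e′ with trans (sym (trans q (cong suc p₀))) (trans e′ p₁)
  ... | ()
  next-next≢ i e | inj₂ (p₀ , _) | inj₂ (_ , q₁) | _ with trans (sym p₀) q₁
  ... | ()

  prev≢ : ∀ i → prev i ≢ i
  prev≢ i e = next≢ i (trans (cong next (sym e)) (next-prev i))

  prev≢next : ∀ i → prev i ≢ next i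
  prev≢next i e = next-next≢ i (trans (cong next (sym e)) (next-prev i))

  nextMod⇔next : ∀ i i' → T (nextMod n i i') ⇔ i' ≡ next i
  nextMod⇔next i i' = mk⇔ to from
    where
    succ? last? : Bool
    succ? = toℕ i' ℕ.≡ᵇ suc (toℕ i)
    last? = suc (toℕ i) ℕ.≡ᵇ n
    to : T (nextMod n i i') → i' ≡ next i
    to t with Equivalence.to (T-∨ {succ?}) t | toℕ-next i
    ... | inj₁ succ | inj₁ p        = toℕ-injective (trans (≡ᵇ⇒≡ _ _ succ) (sym p))
    ... | inj₁ succ | inj₂ (_ , p₁) = ⊥-elim (<-irrefl (trans (≡ᵇ⇒≡ _ _ succ) (cong suc p₁)) (toℕ<n i'))
    ... | inj₂ wrap | inj₁ p with Equivalence.to (T-∧ {last?}) wrap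
    ...   | last , _ = ⊥-elim (<-irrefl (trans p (≡ᵇ⇒≡ _ _ last)) (toℕ<n (next i)))
    to t | inj₂ wrap | inj₂ (p₀ , _) with Equivalence.to (T-∧ {last?}) wrap
    ...   | _ , zero′ = toℕ-injective (trans (≡ᵇ⇒≡ _ _ zero′) (sym p₀))
    from : i' ≡ next i → T (nextMod n i i')
    from refl with toℕ-next i
    ... | inj₁ p         = Equivalence.from (T-∨ {succ?}) (inj₁ (≡⇒≡ᵇ _ _ p))
    ... | inj₂ (p₀ , p₁) =
      Equivalence.from (T-∨ {succ?})
        (inj₂ (Equivalence.from (T-∧ {last?}) (≡⇒≡ᵇ _ _ (cong suc p₁) , ≡⇒≡ᵇ _ _ p₀)))

  cycAdj⇔ : ∀ i i' → T (cycAdj n i i') ⇔ (i' ≡ prev i ⊎ i' ≡ next i)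
  cycAdj⇔ i i' = mk⇔ to from
    where
    to : T (cycAdj n i i') → i' ≡ prev i ⊎ i' ≡ next i
    to t with Equivalence.to (T-∨ {nextMod n i i'}) t
    ... | inj₁ forward  = inj₂ (Equivalence.to (nextMod⇔next i i') forward)
    ... | inj₂ backward = inj₁ (begin
      i'               ≡⟨ sym (prev-next i') ⟩
      prev (next i')   ≡⟨ cong prev (sym (Equivalence.to (nextMod⇔next i' i) backward)) ⟩
      prev i           ∎)
      where open ≡-Reasoning
    from : i' ≡ prev i ⊎ i' ≡ next i → T (cycAdj n i i')
    from (inj₁ refl) = Equivalence.from (T-∨ {nextMod n i (prev i)})
                         (inj₂ (Equivalence.from (nextMod⇔next (prev i) i) (sym (next-prev i))))
    from (inj₂ refl) = Equivalence.from (T-∨ {nextMod n i (next i)})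
                         (inj₁ (Equivalence.from (nextMod⇔next i (next i)) refl))

  module EvenCycle (n-even : odd n ≡ false) where
    odd-next : ∀ i → odd (toℕ (next i)) ≡ not (odd (toℕ i))
    odd-next i with toℕ-next i
    ... | inj₁ p         = cong odd p
    ... | inj₂ (p₀ , p₁) = begin
      odd (toℕ (next i))            ≡⟨ cong odd p₀ ⟩
      false                         ≡⟨ sym n-even ⟩
      not (odd (suc (suc m)))       ≡⟨ cong (λ k → not (odd k)) (sym p₁) ⟩
      not (odd (toℕ i))             ∎
      where open ≡-Reasoning

    odd-prev : ∀ i → odd (toℕ (prev i)) ≡ not (odd (toℕ i))
    odd-prev i = begin
      odd (toℕ (prev i))                   ≡⟨ sym (not-involutive _) ⟩
      not (not (odd (toℕ (prev i))))       ≡⟨ cong not (sym (odd-next (prev i))) ⟩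
      not (odd (toℕ (next (prev i))))      ≡⟨ cong (λ k → not (odd (toℕ k))) (next-prev i) ⟩
      not (odd (toℕ i))                    ∎
      where open ≡-Reasoning

    odd-prev² : ∀ i → odd (toℕ (prev (prev i))) ≡ odd (toℕ i)
    odd-prev² i = trans (odd-prev (prev i)) (trans (cong not (odd-prev i)) (not-involutive _))

    odd-next² : ∀ i → odd (toℕ (next (next i))) ≡ odd (toℕ i)
    odd-next² i = trans (odd-next (next i)) (trans (cong not (odd-next i)) (not-involutive _))

finEq-sound : ∀ {k} (a b : Fin k) → T (finEq a b) → a ≡ b
finEq-sound a b t = toℕ-injective (≡ᵇ⇒≡ (toℕ a) (toℕ b) t)

finEq-refl : ∀ {k} (a : Fin k) → finEq a a ≡ true
finEq-refl a = Equivalence.to T-≡ (≡⇒≡ᵇ (toℕ a) (toℕ a) refl)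

kindEq-sound : ∀ k k' → T (kindEq k k') → k ≡ k'
kindEq-sound kv kv _ = refl
kindEq-sound kx kx _ = refl
kindEq-sound ky ky _ = refl
kindEq-sound kz kz _ = refl

kindEq-refl : ∀ k → kindEq k k ≡ true
kindEq-refl kv = refl
kindEq-refl kx = refl
kindEq-refl ky = refl
kindEq-refl kz = refl

other : Fin 2 → Fin 2
other zero       = suc zero
other (suc zero) = zero

other≢ : ∀ j → j ≢ other j
other≢ zero       ()
other≢ (suc zero) ()

finEq-other : ∀ j → finEq j (other j) ≡ false
finEq-other zero       = refl
finEq-other (suc zero) = refl

other-sound : ∀ j j' → T (not (finEq j j')) → j' ≡ other j
other-sound zero       zero       ()
other-sound zero       (suc zero) _ = refl
other-sound (suc zero) zero       _ = refl
other-sound (suc zero) (suc zero) ()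

-- The closed neighbourhoods of H_n (n ≥ 3), each listed with the vertex itself first.
module Neighbourhoods (m : ℕ) where
  open Cycle m

  nbhd : HV n → List (HV n)
  nbhd (i , j , kv) =
    (i , j , kv) ∷ (prev i , j , kv) ∷ (next i , j , kv) ∷ (i , other j , kv) ∷ (i , j , kz) ∷ []
  nbhd (i , j , kx) = (i , j , kx) ∷ (i , j , ky) ∷ (i , j , kz) ∷ []
  nbhd (i , j , ky) = (i , j , ky) ∷ (i , j , kx) ∷ (i , j , kz) ∷ []
  nbhd (i , j , kz) = (i , j , kz) ∷ (i , j , kx) ∷ (i , j , ky) ∷ (i , j , kv) ∷ []

  cellVerts : Fin n → Fin 2 → List (HV n)
  cellVerts i j = map (λ k → (i , j , k)) kinds

  columnVerts : Fin n → List (HV n)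
  columnVerts i = concatMap (cellVerts i) (allFin 2)

  verts-unique : Unique (Graph.verts (H n))
  verts-unique = concatMap-unique columnVerts proj₁
                   (λ i → refl ∷ refl ∷ refl ∷ refl ∷ refl ∷ refl ∷ refl ∷ refl ∷ [])
                   column-unique (Unique.allFin⁺ n)
    where
    kinds-unique : Unique kinds
    kinds-unique =
      ((λ ()) ∷ (λ ()) ∷ (λ ()) ∷ []) ∷ ((λ ()) ∷ (λ ()) ∷ []) ∷ ((λ ()) ∷ []) ∷ [] ∷ []
    column-unique : ∀ i → Unique (columnVerts i)
    column-unique i = concatMap-unique (cellVerts i) (proj₁ ∘ proj₂) (λ j → refl ∷ refl ∷ refl ∷ refl ∷ [])
      (λ j → Unique.map⁺ {f = λ k → (i , j , k)} (cong (proj₂ ∘ proj₂)) kinds-unique) (Unique.allFin⁺ 2)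

  verts-complete : ∀ x → x ∈ Graph.verts (H n)
  verts-complete (i , j , k) =
    ∈-concat⁺′ (∈-concat⁺′ (∈-map⁺ (λ k → (i , j , k)) (kind∈ k))
                           (∈-map⁺ (cellVerts i) (∈-allFin j)))
               (∈-map⁺ columnVerts (∈-allFin i))
    where
    kind∈ : ∀ k → k ∈ kinds
    kind∈ kv = here refl
    kind∈ kx = there (here refl)
    kind∈ ky = there (there (here refl))
    kind∈ kz = there (there (there (here refl)))

  nbhd-unique : ∀ u → Unique (nbhd u)
  nbhd-unique (i , j , kv) =
      (column≢ (prev≢ i ∘ sym) ∷ column≢ (next≢ i ∘ sym) ∷ row≢ ∷ (λ ()) ∷ [])
    ∷ (column≢ (prev≢next i) ∷ row≢ ∷ (λ ()) ∷ [])
    ∷ (row≢ ∷ (λ ()) ∷ [])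
    ∷ ((λ ()) ∷ []) ∷ [] ∷ []
    where
    column≢ : ∀ {a b : Fin n} {j j' : Fin 2} → a ≢ b → (a , j , kv) ≢ (b , j' , kv)
    column≢ a≢b e = a≢b (cong proj₁ e)
    row≢ : ∀ {a b : Fin n} → (a , j , kv) ≢ (b , other j , kv)
    row≢ e = other≢ j (cong (proj₁ ∘ proj₂) e)
  nbhd-unique (i , j , kx) = ((λ ()) ∷ (λ ()) ∷ []) ∷ ((λ ()) ∷ []) ∷ [] ∷ []
  nbhd-unique (i , j , ky) = ((λ ()) ∷ (λ ()) ∷ []) ∷ ((λ ()) ∷ []) ∷ [] ∷ []
  nbhd-unique (i , j , kz) =
    ((λ ()) ∷ (λ ()) ∷ (λ ()) ∷ []) ∷ ((λ ()) ∷ (λ ()) ∷ []) ∷ ((λ ()) ∷ []) ∷ [] ∷ []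

  closed : HV n → HV n → Bool
  closed u x = Graph._==_ (H n) x u ∨ Hadj n u x

  ==-sound : ∀ x u → T (Graph._==_ (H n) x u) → x ≡ u
  ==-sound (i' , j' , k') (i , j , k) t
    with Equivalence.to (T-∧ {finEq i' i}) t
  ... | ci , rest with Equivalence.to (T-∧ {finEq j' j}) rest
  ... | cj , ck with finEq-sound i' i ci | finEq-sound j' j cj | kindEq-sound k' k ck
  ... | refl | refl | refl = refl

  same-cell : ∀ (i i' : Fin n) (j j' : Fin 2) → T (finEq i i' ∧ finEq j j') → i' ≡ i × j' ≡ j
  same-cell i i' j j' t with Equivalence.to (T-∧ {finEq i i'}) t
  ... | ci , cj = sym (finEq-sound i i' ci) , sym (finEq-sound j j' cj)

  triangle-cell : ∀ (i i' : Fin n) (j j' : Fin 2) b → T (finEq i i' ∧ finEq j j' ∧ b) → i' ≡ i × j' ≡ j × T b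
  triangle-cell i i' j j' b t with Equivalence.to (T-∧ {finEq i i'}) t
  ... | ci , rest with Equivalence.to (T-∧ {finEq j j'}) rest
  ... | cj , tb = sym (finEq-sound i i' ci) , sym (finEq-sound j j' cj) , tb

  adj→∈ : ∀ u x → T (Hadj n u x) → x ∈ nbhd u
  adj→∈ (i , j , kv) (i' , j' , kv) a with Equivalence.to (T-∨ {finEq j j' ∧ cycAdj n i i'}) a
  ... | inj₁ along with Equivalence.to (T-∧ {finEq j j'}) along
  ...   | cj , ca with finEq-sound j j' cj | Equivalence.to (cycAdj⇔ i i') ca
  ...     | refl | inj₁ refl = there (here refl)
  ...     | refl | inj₂ refl = there (there (here refl))
  adj→∈ (i , j , kv) (i' , j' , kv) a | inj₂ rung with Equivalence.to (T-∧ {finEq i i'}) rung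
  ...   | ci , cj with finEq-sound i i' ci | other-sound j j' cj
  ...     | refl | refl = there (there (there (here refl)))
  adj→∈ (i , j , kv) (i' , j' , kz) a with same-cell i i' j j' a
  ... | refl , refl = there (there (there (there (here refl))))
  adj→∈ (i , j , kz) (i' , j' , kv) a with same-cell i i' j j' a
  ... | refl , refl = there (there (there (here refl)))
  adj→∈ (i , j , kx) (i' , j' , ky) a with triangle-cell i i' j j' true a
  ... | refl , refl , _ = there (here refl)
  adj→∈ (i , j , kx) (i' , j' , kz) a with triangle-cell i i' j j' true a
  ... | refl , refl , _ = there (there (here refl))
  adj→∈ (i , j , ky) (i' , j' , kx) a with triangle-cell i i' j j' true a
  ... | refl , refl , _ = there (here refl)
  adj→∈ (i , j , ky) (i' , j' , kz) a with triangle-cell i i' j j' true a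
  ... | refl , refl , _ = there (there (here refl))
  adj→∈ (i , j , kz) (i' , j' , kx) a with triangle-cell i i' j j' true a
  ... | refl , refl , _ = there (here refl)
  adj→∈ (i , j , kz) (i' , j' , ky) a with triangle-cell i i' j j' true a
  ... | refl , refl , _ = there (there (here refl))
  adj→∈ (i , j , kx) (i' , j' , kx) a with triangle-cell i i' j j' false a
  ... | _ , _ , ()
  adj→∈ (i , j , ky) (i' , j' , ky) a with triangle-cell i i' j j' false a
  ... | _ , _ , ()
  adj→∈ (i , j , kz) (i' , j' , kz) a with triangle-cell i i' j j' false a
  ... | _ , _ , ()
  adj→∈ (i , j , kv) (i' , j' , kx) ()
  adj→∈ (i , j , kv) (i' , j' , ky) ()
  adj→∈ (i , j , kx) (i' , j' , kv) ()
  adj→∈ (i , j , ky) (i' , j' , kv) ()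

  listed→closed : ∀ u x → x ∈ nbhd u → x ≡ u ⊎ T (Hadj n u x)
  listed→closed (i , j , kv) x (here refl) = inj₁ refl
  listed→closed (i , j , kv) x (there (here refl))
    rewrite finEq-refl j | Equivalence.to T-≡ (Equivalence.from (cycAdj⇔ i (prev i)) (inj₁ refl)) = inj₂ tt
  listed→closed (i , j , kv) x (there (there (here refl)))
    rewrite finEq-refl j | Equivalence.to T-≡ (Equivalence.from (cycAdj⇔ i (next i)) (inj₂ refl)) = inj₂ tt
  listed→closed (i , j , kv) x (there (there (there (here refl))))
    rewrite finEq-refl i | finEq-other j = inj₂ tt
  listed→closed (i , j , kv) x (there (there (there (there (here refl)))))
    rewrite finEq-refl i | finEq-refl j = inj₂ tt
  listed→closed (i , j , kx) x (here refl) = inj₁ refl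
  listed→closed (i , j , kx) x (there (here refl)) rewrite finEq-refl i | finEq-refl j = inj₂ tt
  listed→closed (i , j , kx) x (there (there (here refl))) rewrite finEq-refl i | finEq-refl j = inj₂ tt
  listed→closed (i , j , ky) x (here refl) = inj₁ refl
  listed→closed (i , j , ky) x (there (here refl)) rewrite finEq-refl i | finEq-refl j = inj₂ tt
  listed→closed (i , j , ky) x (there (there (here refl))) rewrite finEq-refl i | finEq-refl j = inj₂ tt
  listed→closed (i , j , kz) x (here refl) = inj₁ refl
  listed→closed (i , j , kz) x (there (here refl)) rewrite finEq-refl i | finEq-refl j = inj₂ tt
  listed→closed (i , j , kz) x (there (there (here refl))) rewrite finEq-refl i | finEq-refl j = inj₂ tt
  listed→closed (i , j , kz) x (there (there (there (here refl)))) rewrite finEq-refl i | finEq-refl j = inj₂ tt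

  closed⇔listed : ∀ u {x} → T (closed u x) ⇔ x ∈ nbhd u
  closed⇔listed u {x} = mk⇔ to from
    where
    to : T (closed u x) → x ∈ nbhd u
    to t with Equivalence.to (T-∨ {Graph._==_ (H n) x u}) t
    ... | inj₁ same     = subst (_∈ nbhd u) (sym (==-sound x u same)) (self∈ u)
      where
      self∈ : ∀ u → u ∈ nbhd u
      self∈ (_ , _ , kv) = here refl
      self∈ (_ , _ , kx) = here refl
      self∈ (_ , _ , ky) = here refl
      self∈ (_ , _ , kz) = here refl
    ... | inj₂ adjacent = adj→∈ u x adjacent
    from : x ∈ nbhd u → T (closed u x)
    from x∈ with listed→closed u x x∈
    ... | inj₁ refl     = Equivalence.from (T-∨ {Graph._==_ (H n) u u}) (inj₁ (==-refl u))
      where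
      ==-refl : ∀ u → T (Graph._==_ (H n) u u)
      ==-refl (i , j , k) rewrite finEq-refl i | finEq-refl j | kindEq-refl k = tt
    ... | inj₂ adjacent = Equivalence.from (T-∨ {Graph._==_ (H n) x u}) (inj₂ adjacent)

  N↭nbhd : ∀ u → Process.N[_] (H n) u ↭ nbhd u
  N↭nbhd u = filter-enumeration-↭ (closed u) verts-unique verts-complete (nbhd-unique u) (closed⇔listed u)

-- A vertex of a wave only sees
-- the interrupter flags of at most five consecutive columns, so each local
-- rule is a statement about finitely many Boolean patterns, decided by
-- evaluation.

∀-Bool? : {P : Bool → Set} → (∀ b → Dec (P b)) → Dec (∀ b → P b)
∀-Bool? P? with P? false | P? true
... | yes pf | yes pt = yes λ { false → pf ; true → pt }
... | no ¬pf | _      = no λ all → ¬pf (all false)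
... | yes _  | no ¬pt = no λ all → ¬pt (all true)

_≟S_ : (s t : Strategy) → Dec (s ≡ t)
C ≟S C = yes refl
C ≟S D = no λ ()
D ≟S C = no λ ()
D ≟S D = yes refl

rowW : Fin 2 → Strategy
rowW zero       = C
rowW (suc zero) = D

-- the strategy of v_{i,j} in a wave on row r, where β says whether column i
-- carries an interrupter
cell : Fin 2 → Fin 2 → Bool → Strategy
cell r j β = if finEq j r ∧ β then flipS (rowW j) else rowW j

-- the condition on the flags at columns i - 2, …, i + 2 under which the wave
-- updates correctly at column i: no interrupter at i ± 1, or none at i - 2, i, i + 2
Sparse : (pp p c nx nn : Bool) → Set
Sparse pp p c nx nn = (p ≡ false × nx ≡ false) ⊎ (pp ≡ false × c ≡ false × nn ≡ false)

sparse? : ∀ pp p c nx nn → Dec (Sparse pp p c nx nn)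
sparse? pp p c nx nn =
  (p Bool.≟ false ×-dec nx Bool.≟ false) ⊎-dec (pp Bool.≟ false ×-dec c Bool.≟ false ×-dec nn Bool.≟ false)

-- the entry of a snapshot for a vertex with strategy s whose closed
-- neighbourhood, listed with the vertex first, carries s ∷ ss
entry : Strategy → List Strategy → Strategy × ℚ
entry s ss = s , localPower s (s ∷ ss)

-- the snapshot at v_{i,j} of a wave on row r with flags pp p c nx nn at
-- columns i - 2, …, i + 2, in the order of nbhd
vertexView : Fin 2 → Fin 2 → (pp p c nx nn : Bool) → List (Strategy × ℚ)
vertexView r j pp p c nx nn =
    entry (cell r j c)         (cell r j p ∷ cell r j nx ∷ cell r (other j) c ∷ rowW j ∷ [])
  ∷ entry (cell r j p)         (cell r j pp ∷ cell r j c ∷ cell r (other j) p ∷ rowW j ∷ [])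
  ∷ entry (cell r j nx)        (cell r j c ∷ cell r j nn ∷ cell r (other j) nx ∷ rowW j ∷ [])
  ∷ entry (cell r (other j) c) (cell r (other j) p ∷ cell r (other j) nx ∷ cell r (other (other j)) c
                                ∷ rowW (other j) ∷ [])
  ∷ entry (rowW j)             (rowW j ∷ rowW j ∷ cell r j c ∷ [])
  ∷ []

vertexRule : ∀ r j pp p c nx nn → Sparse pp p c nx nn →
  localStep (cell r j c) (vertexView r j pp p c nx nn) ≡ cell (other r) j (p xor nx)
vertexRule = from-yes
  (all? λ r → all? λ j →
   ∀-Bool? λ pp → ∀-Bool? λ p → ∀-Bool? λ c → ∀-Bool? λ nx → ∀-Bool? λ nn →
     sparse? pp p c nx nn
       →-dec (localStep (cell r j c) (vertexView r j pp p c nx nn) ≟S cell (other r) j (p xor nx)))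

-- the snapshot at z_{i,j}, with flags p c nx at columns i - 1, i, i + 1
pendantView : Fin 2 → Fin 2 → (p c nx : Bool) → List (Strategy × ℚ)
pendantView r j p c nx =
    entry (rowW j)     (rowW j ∷ rowW j ∷ cell r j c ∷ [])
  ∷ entry (rowW j)     (rowW j ∷ rowW j ∷ [])
  ∷ entry (rowW j)     (rowW j ∷ rowW j ∷ [])
  ∷ entry (cell r j c) (cell r j p ∷ cell r j nx ∷ cell r (other j) c ∷ rowW j ∷ [])
  ∷ []

-- the snapshot at x_{i,j} and at y_{i,j}, with flag c at column i
triangleView : Fin 2 → Fin 2 → (c : Bool) → List (Strategy × ℚ)
triangleView r j c =
    entry (rowW j) (rowW j ∷ rowW j ∷ [])
  ∷ entry (rowW j) (rowW j ∷ rowW j ∷ [])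
  ∷ entry (rowW j) (rowW j ∷ rowW j ∷ cell r j c ∷ [])
  ∷ []

pendantRule : ∀ r j p c nx → localStep (rowW j) (pendantView r j p c nx) ≡ rowW j
pendantRule = from-yes (all? λ r → all? λ j → ∀-Bool? λ p → ∀-Bool? λ c → ∀-Bool? λ nx →
  localStep (rowW j) (pendantView r j p c nx) ≟S rowW j)

triangleRule : ∀ r j c → localStep (rowW j) (triangleView r j c) ≡ rowW j
triangleRule = from-yes (all? λ r → all? λ j → ∀-Bool? λ c → localStep (rowW j) (triangleView r j c) ≟S rowW j)

module Waves (m : ℕ) where
  open Cycle m
  open Neighbourhoods m
  open Process (H n) using (step)
  open Locality (H n) nbhd N↭nbhd using (snapshot; step-local)

  wave : Fin 2 → (Fin n → Bool) → Config (H n)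
  wave r b (i , j , kv) = cell r j (b i)
  wave r b (i , j , _)  = rowW j

  rule90Step : (Fin n → Bool) → Fin n → Bool
  rule90Step b i = b (prev i) xor b (next i)

  SparseAt : (Fin n → Bool) → Fin n → Set
  SparseAt b i = Sparse (b (prev (prev i))) (b (prev i)) (b i) (b (next i)) (b (next (next i)))

  wave-step : ∀ r b → (∀ i → SparseAt b i) → ∀ v → step (wave r b) v ≡ wave (other r) (rule90Step b) v
  wave-step r b sparse (i , j , kv) = begin
    step (wave r b) (i , j , kv)                                   ≡⟨ step-local (wave r b) (i , j , kv) ⟩
    localStep (cell r j (b i)) (snapshot (wave r b) (i , j , kv))  ≡⟨ cong (localStep (cell r j (b i))) snapshot-v ⟩
    localStep (cell r j (b i)) (vertexView r j _ _ _ _ _)          ≡⟨ vertexRule r j _ _ _ _ _ (sparse i) ⟩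
    cell (other r) j (rule90Step b i)                              ∎
    where
    open ≡-Reasoning
    -- the neighbours of v_{i±1,j} include v_{i,j} itself
    snapshot-v : snapshot (wave r b) (i , j , kv)
                 ≡ vertexView r j (b (prev (prev i))) (b (prev i)) (b i) (b (next i)) (b (next (next i)))
    snapshot-v rewrite next-prev i | prev-next i = refl
  wave-step r b sparse (i , j , kx) = trans (step-local (wave r b) (i , j , kx)) (triangleRule r j (b i))
  wave-step r b sparse (i , j , ky) = trans (step-local (wave r b) (i , j , ky)) (triangleRule r j (b i))
  wave-step r b sparse (i , j , kz) =
    trans (step-local (wave r b) (i , j , kz)) (pendantRule r j (b (prev i)) (b i) (b (next i)))

module Rule90 (m : ℕ) where
  open Cycle m
  open Waves m using (rule90Step; SparseAt)

  cycle-neighbours : ∀ i → filterᵇ (cycAdj n i) (allFin n) ↭ prev i ∷ next i ∷ []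
  cycle-neighbours i = filter-enumeration-↭ (cycAdj n i) (Unique.allFin⁺ n) ∈-allFin
                         ((prev≢next i ∷ []) ∷ [] ∷ []) (mk⇔ to from)
    where
    to : ∀ {x} → T (cycAdj n i x) → x ∈ prev i ∷ next i ∷ []
    to {x} t with Equivalence.to (cycAdj⇔ i x) t
    ... | inj₁ refl = here refl
    ... | inj₂ refl = there (here refl)
    from : ∀ {x} → x ∈ prev i ∷ next i ∷ [] → T (cycAdj n i x)
    from (here refl)         = Equivalence.from (cycAdj⇔ i _) (inj₁ refl)
    from (there (here refl)) = Equivalence.from (cycAdj⇔ i _) (inj₂ refl)

  rule90-suc : ∀ t i → rule90 n (suc t) i ≡ rule90Step (rule90 n t) i
  rule90-suc t i = begin
    does (length (filterᵇ (λ i' → cycAdj n i i' ∧ rule90 n t i') (allFin n)) ℕ.≟ 1)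
      ≡⟨ cong (λ xs → does (length xs ℕ.≟ 1)) (filterᵇ-∧ (cycAdj n i) (rule90 n t) (allFin n)) ⟩
    does (length (filterᵇ (rule90 n t) (filterᵇ (cycAdj n i) (allFin n))) ℕ.≟ 1)
      ≡⟨ cong (λ k → does (k ℕ.≟ 1)) (↭-length (filter-↭ _ (cycle-neighbours i))) ⟩
    does (length (filterᵇ (rule90 n t) (prev i ∷ next i ∷ [])) ℕ.≟ 1)
      ≡⟨ exactly-one (rule90 n t) (prev i) (next i) ⟩
    rule90 n t (prev i) xor rule90 n t (next i) ∎
    where open ≡-Reasoning

  module EvenRule90 (n-even : odd n ≡ false) where
    open EvenCycle n-even

    live-parity : ∀ k i → rule90 n k i ≡ true → odd (toℕ i) ≡ odd k
    live-parity zero i live = cong odd (≡ᵇ⇒≡ (toℕ i) 0 (Equivalence.from T-≡ live))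
    live-parity (suc k) i live with xor-true (rule90 n k (prev i)) _ (trans (sym (rule90-suc k i)) live)
    ... | inj₁ prev-live = flip-parity (odd-prev i) (live-parity k (prev i) prev-live)
    ... | inj₂ next-live = flip-parity (odd-next i) (live-parity k (next i) next-live)

    dead : ∀ k i → odd (toℕ i) ≢ odd k → rule90 n k i ≡ false
    dead k i wrong-parity with rule90 n k i in live
    ... | true  = ⊥-elim (wrong-parity (live-parity k i live))
    ... | false = refl

    sparse : ∀ k i → SparseAt (rule90 n k) i
    sparse k i with odd (toℕ i) Bool.≟ odd k
    ... | yes same = inj₁ (dead k (prev i) (λ e → not-¬ same (flip-parity (odd-prev i) e)) ,
                          dead k (next i) (λ e → not-¬ same (flip-parity (odd-next i) e)))
    ... | no differ = inj₂ (dead k (prev (prev i)) (λ e → differ (trans (sym (odd-prev² i)) e)) ,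
                           dead k i differ ,
                           dead k (next (next i)) (λ e → differ (trans (sym (odd-next² i)) e)))

Interrupted : ∀ {n} → Config (H n) → Fin n → Set
Interrupted {n} σ i = (¬ σ (vtx i zero) ≡ W n (vtx i zero)) ⊎ (¬ σ (vtx i (suc zero)) ≡ W n (vtx i (suc zero)))

unchanged : {A : Set} → (¬ C ≡ C) ⊎ (¬ D ≡ D) → A
unchanged (inj₁ C≢C) = ⊥-elim (C≢C refl)
unchanged (inj₂ D≢D) = ⊥-elim (D≢D refl)

module WaveDynamics (m : ℕ) (n-even : odd (suc (suc (suc m))) ≡ false) where
  open Cycle m
  open Neighbourhoods m
  open Waves m
  open Rule90 m
  open EvenRule90 n-even
  open Process (H n) using (step; run)
  open Locality (H n) nbhd N↭nbhd using (step-cong)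

  row : ℕ → Fin 2
  row k = if odd k then zero else suc zero

  row-suc : ∀ k → other (row k) ≡ row (suc k)
  row-suc k with odd k
  ... | true  = refl
  ... | false = refl

  wave-cong : ∀ {r r' b b'} → r ≡ r' → (∀ i → b i ≡ b' i) → ∀ v → wave r b v ≡ wave r' b' v
  wave-cong r≡r' b≗b' (i , j , kv) = cong₂ (λ r β → cell r j β) r≡r' (b≗b' i)
  wave-cong r≡r' b≗b' (i , j , kx) = refl
  wave-cong r≡r' b≗b' (i , j , ky) = refl
  wave-cong r≡r' b≗b' (i , j , kz) = refl

  initial-wave : ∀ v → waveC0 n v ≡ wave (row 0) (rule90 n 0) v
  initial-wave (i     , zero     , kv) = refl
  initial-wave (zero  , suc zero , kv) = refl
  initial-wave (suc i , suc zero , kv) = refl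
  initial-wave (i     , zero     , kx) = refl
  initial-wave (i     , zero     , ky) = refl
  initial-wave (i     , zero     , kz) = refl
  initial-wave (i     , suc zero , kx) = refl
  initial-wave (i     , suc zero , ky) = refl
  initial-wave (i     , suc zero , kz) = refl

  run-wave : ∀ k v → run (waveC0 n) k v ≡ wave (row k) (rule90 n k) v
  run-wave zero    v = initial-wave v
  run-wave (suc k) v = begin
    step (run (waveC0 n) k) v                           ≡⟨ step-cong (run-wave k) v ⟩
    step (wave (row k) (rule90 n k)) v                  ≡⟨ wave-step (row k) (rule90 n k) (sparse k) v ⟩
    wave (other (row k)) (rule90Step (rule90 n k)) v    ≡⟨ wave-cong (row-suc k) (λ i → sym (rule90-suc k i)) v ⟩
    wave (row (suc k)) (rule90 n (suc k)) v             ∎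
    where open ≡-Reasoning

  wave-interrupted : ∀ r b i → Interrupted (wave r b) i ⇔ (b i ≡ true)
  wave-interrupted r b i with b i
  wave-interrupted zero       b i | true  = mk⇔ (λ _ → refl) (λ _ → inj₁ λ ())
  wave-interrupted (suc zero) b i | true  = mk⇔ (λ _ → refl) (λ _ → inj₂ λ ())
  wave-interrupted zero       b i | false = mk⇔ unchanged λ ()
  wave-interrupted (suc zero) b i | false = mk⇔ unchanged λ ()

  interrupted⇔live : ∀ k i → Interrupted (run (waveC0 n) k) i ⇔ (rule90 n k i ≡ true)
  interrupted⇔live k i
    rewrite run-wave k (vtx i zero) | run-wave k (vtx i (suc zero)) = wave-interrupted (row k) (rule90 n k) i

mainTheorem11 : ∀ (n : ℕ) → 4 ≤ n → 2 ∣ n → ∀ (k : ℕ) (i : Fin n) →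
    ((¬ (Process.run (H n) (waveC0 n) k (vtx i zero) ≡ W n (vtx i zero)))
      ⊎ (¬ (Process.run (H n) (waveC0 n) k (vtx i (suc zero)) ≡ W n (vtx i (suc zero)))))
    ⇔ (rule90 n k i ≡ true)
mainTheorem11 (suc (suc (suc (suc m)))) (s≤s (s≤s (s≤s (s≤s _)))) (divides q n≡q*2) =
  WaveDynamics.interrupted⇔live (suc m) (trans (cong odd n≡q*2) (odd-double q))
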